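{- Let $s$ be a positive integer and let $n$ be a positive integer with $n\in\{1,2,s-7,s-6,\dots,s-1,s\}$. Then there is no positive integer $p$ such that $(s,p,n)$ is admissible.
   Context: For a multiset $\{x_1,\dots,x_n\}$ of positive integers define $T\{x_1,\dots,x_n\}=(x_1+\cdots+x_n,\,x_1x_2\cdots x_n,\,n)$. An ordered triple $(s,p,n)$ of positive integers is called admissible if there exist at least two different multisets $X$, $Y$ of $n$ positive integers with $T(X)=T(Y)=(s,p,n)$. -}

module Defs where

open import Data.Nat using (ℕ; _≤_; _+_)
open import Data.List using (List; length)
open import Data.Nat.ListAction using (sum; product)
open import Data.List.Relation.Unary.All using (All)
open import Data.List.Relation.Binary.Permutation.Propositional using (_↭_)
open import Data.Product using (Σ; _×_; ∃)
open import Relation.Nullary using (¬_)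
open import Relation.Binary.PropositionalEquality using (_≡_)

-- A finite multiset of natural numbers is represented by a list,
-- two lists denoting the same multiset iff they are permutations of each other.
HasT : ℕ → ℕ → ℕ → List ℕ → Set
HasT s p n X = All (λ x → 1 ≤ x) X × sum X ≡ s × product X ≡ p × length X ≡ n

Admissible : ℕ → ℕ → ℕ → Set
Admissible s p n =
  Σ (List ℕ) λ X → Σ (List ℕ) λ Y → HasT s p n X × HasT s p n Y × ¬ (X ↭ Y)

{-# OPTIONS --safe #-}
module Submission where

-- For n = 1 a multiset is its sum, and for n = 2 its sum and product determine it (Vieta).
-- For n ≤ s ≤ n + 7 the excess Σ (xᵢ − 1) = s − n is at most 7. Discarding the ones leaves a
-- multiset of entries ≥ 2 with the same excess and product; there are only finitely many such
-- multisets, and a finite check shows that excess and product tell them apart. The number of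
-- discarded ones is then fixed by n.

open import Defs
open import Data.Nat using (ℕ; _≤_; _+_)
open import Data.Sum using (_⊎_)
open import Data.Product using (_×_)
open import Relation.Nullary using (¬_)
open import Relation.Binary.PropositionalEquality using (_≡_)

open import Data.Nat using (zero; suc; pred; _*_; _∸_; _<_; _≤?_; _≟_; s≤s; z≤n)
open import Data.Nat.Properties
open import Data.Sum using (inj₁; inj₂)
open import Data.Product using (_,_)
open import Data.List using (List; []; _∷_; [_]; map; concatMap; filter; upTo; length; replicate; _++_)
open import Data.List.Properties using (≡-dec)
open import Data.Nat.ListAction using (sum; product)
open import Data.Nat.ListAction.Properties using (sum-↭; product-↭)
open import Data.List.Relation.Unary.All as All using (All; []; _∷_; all?)
open import Data.List.Relation.Unary.Any as Any using (here; there)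
open import Data.List.Relation.Unary.Linked as Linked using (Linked; []; [-]; _∷_)
open import Data.List.Membership.Propositional using (_∈_)
open import Data.List.Membership.Propositional.Properties using (∈-concatMap⁺; ∈-map⁺; ∈-filter⁺; ∈-upTo⁺)
open import Data.List.Relation.Binary.Permutation.Propositional
  using (_↭_; ↭-refl; ↭-reflexive; ↭-sym; ↭-trans; prep; swap; module PermutationReasoning)
open import Data.List.Relation.Binary.Permutation.Propositional.Properties
  using (shift; All-resp-↭; ↭-length; ++⁺ʳ; map⁺)
open import Data.List.Sort ≤-decTotalOrder using (sort; sort-↭; sort-↗)
open import Relation.Nullary.Decidable using (toWitness; _→-dec_)
open import Relation.Binary.PropositionalEquality using (refl; sym; trans; cong; module ≡-Reasoning)
open import Data.Unit using (tt)

shifted-pair-sum-product : ∀ a b t d → a + b ≡ (a + t) + d → a * b ≡ (a + t) * d →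
                           (t ≡ 0 × b ≡ d) ⊎ (a ≡ d × b ≡ a + t)
shifted-pair-sum-product a b zero d Σ≡ _ =
  inj₁ (refl , +-cancelˡ-≡ a b d (trans Σ≡ (cong (_+ d) (+-identityʳ a))))
shifted-pair-sum-product a b (suc u) d Σ≡ Π≡ =
  inj₂ (a≡d , trans b≡t+d (trans (cong (suc u +_) (sym a≡d)) (+-comm (suc u) a)))
  where
  b≡t+d : b ≡ suc u + d
  b≡t+d = +-cancelˡ-≡ a b (suc u + d) (trans Σ≡ (+-assoc a (suc u) d))
  a≡d : a ≡ d
  a≡d = *-cancelˡ-≡ a d (suc u) (+-cancelʳ-≡ (a * d) (suc u * a) (suc u * d) (begin
    suc u * a + a * d      ≡⟨ cong (_+ a * d) (*-comm (suc u) a) ⟩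
    a * suc u + a * d      ≡⟨ *-distribˡ-+ a (suc u) d ⟨
    a * (suc u + d)        ≡⟨ cong (a *_) b≡t+d ⟨
    a * b                  ≡⟨ Π≡ ⟩
    (a + suc u) * d        ≡⟨ *-distribʳ-+ d a (suc u) ⟩
    a * d + suc u * d      ≡⟨ +-comm (a * d) (suc u * d) ⟩
    suc u * d + a * d      ∎))
    where open ≡-Reasoning

pair-sum-product : ∀ {a b c d} → a + b ≡ c + d → a * b ≡ c * d → (a ≡ c × b ≡ d) ⊎ (a ≡ d × b ≡ c)
pair-sum-product {a} {b} {c} {d} Σ≡ Π≡ with ≤-total a c
... | inj₁ a≤c with m≤n⇒∃[o]m+o≡n a≤c
...   | t , refl with shifted-pair-sum-product a b t d Σ≡ Π≡
...     | inj₁ (refl , b≡d) = inj₁ (sym (+-identityʳ a) , b≡d)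
...     | inj₂ swapped = inj₂ swapped
pair-sum-product {a} {b} {c} {d} Σ≡ Π≡ | inj₂ c≤a with m≤n⇒∃[o]m+o≡n c≤a
...   | t , refl with shifted-pair-sum-product c d t b (sym Σ≡) (sym Π≡)
...     | inj₁ (refl , d≡b) = inj₁ (+-identityʳ c , sym d≡b)
...     | inj₂ (c≡b , d≡a) = inj₂ (sym d≡a , sym c≡b)

excess : List ℕ → ℕ
excess xs = sum (map pred xs)

excess-↭ : ∀ {xs ys} → xs ↭ ys → excess xs ≡ excess ys
excess-↭ xs↭ys = sum-↭ (map⁺ pred xs↭ys)

excess+length≡sum : ∀ xs → All (1 ≤_) xs → excess xs + length xs ≡ sum xs
excess+length≡sum [] [] = refl
excess+length≡sum (suc x ∷ xs) (_ ∷ pos) = begin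
  x + excess xs + suc (length xs)    ≡⟨ +-suc (x + excess xs) (length xs) ⟩
  suc (x + excess xs + length xs)    ≡⟨ cong suc (+-assoc x (excess xs) (length xs)) ⟩
  suc (x + (excess xs + length xs))  ≡⟨ cong (λ m → suc (x + m)) (excess+length≡sum xs pos) ⟩
  suc (x + sum xs)                   ∎
  where open ≡-Reasoning

length≤excess : ∀ xs → All (2 ≤_) xs → length xs ≤ excess xs
length≤excess [] [] = z≤n
length≤excess (suc zero ∷ xs) (s≤s () ∷ _)
length≤excess (suc (suc x) ∷ xs) (_ ∷ big) = s≤s (≤-trans (length≤excess xs big) (m≤n+m (excess xs) x))

dropOnes : List ℕ → List ℕ
dropOnes [] = []
dropOnes (zero ∷ xs) = zero ∷ dropOnes xs
dropOnes (suc zero ∷ xs) = dropOnes xs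
dropOnes (suc (suc x) ∷ xs) = suc (suc x) ∷ dropOnes xs

countOnes : List ℕ → ℕ
countOnes [] = 0
countOnes (zero ∷ xs) = countOnes xs
countOnes (suc zero ∷ xs) = suc (countOnes xs)
countOnes (suc (suc x) ∷ xs) = countOnes xs

↭-dropOnes++ones : ∀ xs → xs ↭ dropOnes xs ++ replicate (countOnes xs) 1
↭-dropOnes++ones [] = ↭-refl
↭-dropOnes++ones (zero ∷ xs) = prep zero (↭-dropOnes++ones xs)
↭-dropOnes++ones (suc zero ∷ xs) =
  ↭-trans (prep 1 (↭-dropOnes++ones xs)) (↭-sym (shift 1 (dropOnes xs) (replicate (countOnes xs) 1)))
↭-dropOnes++ones (suc (suc x) ∷ xs) = prep (suc (suc x)) (↭-dropOnes++ones xs)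

length-dropOnes : ∀ xs → length xs ≡ length (dropOnes xs) + countOnes xs
length-dropOnes [] = refl
length-dropOnes (zero ∷ xs) = cong suc (length-dropOnes xs)
length-dropOnes (suc zero ∷ xs) = trans (cong suc (length-dropOnes xs)) (sym (+-suc _ _))
length-dropOnes (suc (suc x) ∷ xs) = cong suc (length-dropOnes xs)

product-dropOnes : ∀ xs → product (dropOnes xs) ≡ product xs
product-dropOnes [] = refl
product-dropOnes (zero ∷ xs) = refl
product-dropOnes (suc zero ∷ xs) = trans (product-dropOnes xs) (sym (+-identityʳ _))
product-dropOnes (suc (suc x) ∷ xs) = cong (suc (suc x) *_) (product-dropOnes xs)

excess-dropOnes : ∀ xs → excess (dropOnes xs) ≡ excess xs
excess-dropOnes [] = refl
excess-dropOnes (zero ∷ xs) = excess-dropOnes xs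
excess-dropOnes (suc zero ∷ xs) = excess-dropOnes xs
excess-dropOnes (suc (suc x) ∷ xs) = cong (suc x +_) (excess-dropOnes xs)

dropOnes-≥2 : ∀ xs → All (1 ≤_) xs → All (2 ≤_) (dropOnes xs)
dropOnes-≥2 [] [] = []
dropOnes-≥2 (suc zero ∷ xs) (_ ∷ pos) = dropOnes-≥2 xs pos
dropOnes-≥2 (suc (suc x) ∷ xs) (_ ∷ pos) = s≤s (s≤s z≤n) ∷ dropOnes-≥2 xs pos

↭-from-dropOnes : ∀ xs ys → dropOnes xs ↭ dropOnes ys → length xs ≡ length ys → xs ↭ ys
↭-from-dropOnes xs ys rest↭ |xs|≡|ys| = begin
  xs                                         ↭⟨ ↭-dropOnes++ones xs ⟩
  dropOnes xs ++ replicate (countOnes xs) 1  ↭⟨ ++⁺ʳ (replicate (countOnes xs) 1) rest↭ ⟩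
  dropOnes ys ++ replicate (countOnes xs) 1  ≡⟨ cong (λ k → dropOnes ys ++ replicate k 1) sameOnes ⟩
  dropOnes ys ++ replicate (countOnes ys) 1  ↭⟨ ↭-dropOnes++ones ys ⟨
  ys                                         ∎
  where
  open PermutationReasoning
  sameOnes : countOnes xs ≡ countOnes ys
  sameOnes = +-cancelˡ-≡ (length (dropOnes xs)) (countOnes xs) (countOnes ys)
    (trans (sym (length-dropOnes xs)) (trans |xs|≡|ys|
      (trans (length-dropOnes ys) (cong (_+ countOnes ys) (sym (↭-length rest↭))))))

partitionsFrom : (fuel lo budget : ℕ) → List (List ℕ)
partitionsFrom zero lo b = [ [] ]
partitionsFrom (suc f) lo b =
  [] ∷ concatMap (λ x → map (x ∷_) (partitionsFrom f x (b ∸ pred x))) (filter (lo ≤?_) (upTo (2 + b)))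

pred≤⇒<2+ : ∀ x {b} → pred x ≤ b → x < 2 + b
pred≤⇒<2+ zero _ = s≤s z≤n
pred≤⇒<2+ (suc x) x≤b = s≤s (s≤s x≤b)

∈-partitionsFrom : ∀ f lo b xs → length xs ≤ f → excess xs ≤ b → Linked _≤_ (lo ∷ xs) →
                   xs ∈ partitionsFrom f lo b
∈-partitionsFrom zero lo b [] _ _ _ = here refl
∈-partitionsFrom (suc f) lo b [] _ _ _ = here refl
∈-partitionsFrom (suc f) lo b (x ∷ ys) (s≤s |ys|≤f) excess≤b sorted =
  there (∈-concatMap⁺ (λ z → map (z ∷_) (partitionsFrom f z (b ∸ pred z))) (Any.map (λ { refl → ∈-map⁺ (x ∷_) ys∈ }) x∈candidates))
  where
  px≤b : pred x ≤ b
  px≤b = ≤-trans (m≤m+n (pred x) (excess ys)) excess≤b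
  x∈candidates : x ∈ filter (lo ≤?_) (upTo (2 + b))
  x∈candidates = ∈-filter⁺ (lo ≤?_) (∈-upTo⁺ (pred≤⇒<2+ x px≤b)) (Linked.head sorted)
  ys∈ : ys ∈ partitionsFrom f x (b ∸ pred x)
  ys∈ = ∈-partitionsFrom f x (b ∸ pred x) ys |ys|≤f
          (m+n≤o⇒m≤o∸n (excess ys) (≤-trans (≤-reflexive (+-comm (excess ys) (pred x))) excess≤b)) (Linked.tail sorted)

smallPartitions : List (List ℕ)
smallPartitions = partitionsFrom 7 2 7

excess-product-injective :
  All (λ xs → All (λ ys → excess xs ≡ excess ys → product xs ≡ product ys → xs ≡ ys) smallPartitions)
      smallPartitions
excess-product-injective = toWitness {a? = all? (λ xs → all? (λ ys →
  (excess xs ≟ excess ys) →-dec (product xs ≟ product ys) →-dec ≡-dec _≟_ xs ys) smallPartitions) smallPartitions} tt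

sorted-∈-smallPartitions : ∀ {xs} → Linked _≤_ xs → All (2 ≤_) xs → excess xs ≤ 7 → xs ∈ smallPartitions
sorted-∈-smallPartitions {xs} sorted big excess≤7 =
  ∈-partitionsFrom 7 2 7 xs (≤-trans (length≤excess xs big) excess≤7) excess≤7 (bounded sorted big)
  where
  bounded : ∀ {ys} → Linked _≤_ ys → All (2 ≤_) ys → Linked _≤_ (2 ∷ ys)
  bounded [] [] = [-]
  bounded sorted (2≤y ∷ _) = 2≤y ∷ sorted

small-excess-↭ : ∀ {xs ys} → All (2 ≤_) xs → All (2 ≤_) ys →
                 excess xs ≡ excess ys → product xs ≡ product ys → excess xs ≤ 7 → xs ↭ ys
small-excess-↭ {xs} {ys} bigxs bigys excess≡ product≡ excess≤7 = begin
  xs       ↭⟨ sort-↭ xs ⟨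
  sort xs  ≡⟨ All.lookup (All.lookup excess-product-injective sxs∈) sys∈ sortedExcess≡ sortedProduct≡ ⟩
  sort ys  ↭⟨ sort-↭ ys ⟩
  ys       ∎
  where
  open PermutationReasoning
  sortedExcess≡ : excess (sort xs) ≡ excess (sort ys)
  sortedExcess≡ = trans (excess-↭ (sort-↭ xs)) (trans excess≡ (sym (excess-↭ (sort-↭ ys))))
  sortedProduct≡ : product (sort xs) ≡ product (sort ys)
  sortedProduct≡ = trans (product-↭ (sort-↭ xs)) (trans product≡ (sym (product-↭ (sort-↭ ys))))
  sxs∈ : sort xs ∈ smallPartitions
  sxs∈ = sorted-∈-smallPartitions (sort-↗ xs) (All-resp-↭ (↭-sym (sort-↭ xs)) bigxs)
           (≤-trans (≤-reflexive (excess-↭ (sort-↭ xs))) excess≤7)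
  sys∈ : sort ys ∈ smallPartitions
  sys∈ = sorted-∈-smallPartitions (sort-↗ ys) (All-resp-↭ (↭-sym (sort-↭ ys)) bigys)
           (≤-trans (≤-reflexive (trans (excess-↭ (sort-↭ ys)) (sym excess≡))) excess≤7)

excess+n≡s : ∀ {s p n X} → HasT s p n X → excess X + n ≡ s
excess+n≡s {X = X} (pos , sum≡s , _ , refl) = trans (excess+length≡sum X pos) sum≡s

excess≤7-determined : ∀ {s p n X Y} → s ≤ n + 7 → HasT s p n X → HasT s p n Y → X ↭ Y
excess≤7-determined {n = n} {X} {Y} s≤n+7 hX@(posX , _ , productX , lengthX) hY@(posY , _ , productY , lengthY) =
  ↭-from-dropOnes X Y
    (small-excess-↭ (dropOnes-≥2 X posX) (dropOnes-≥2 Y posY)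
      (trans (excess-dropOnes X) (trans excess≡ (sym (excess-dropOnes Y))))
      (trans (product-dropOnes X) (trans productX (sym (trans (product-dropOnes Y) productY))))
      (≤-trans (≤-reflexive (excess-dropOnes X)) excessX≤7))
    (trans lengthX (sym lengthY))
  where
  excess≡ : excess X ≡ excess Y
  excess≡ = +-cancelʳ-≡ n (excess X) (excess Y) (trans (excess+n≡s hX) (sym (excess+n≡s hY)))
  excessX≤7 : excess X ≤ 7
  excessX≤7 = +-cancelˡ-≤ n (excess X) 7
    (≤-trans (≤-reflexive (trans (+-comm n (excess X)) (excess+n≡s hX))) s≤n+7)

singleton-determined : ∀ {s p X Y} → HasT s p 1 X → HasT s p 1 Y → X ↭ Y
singleton-determined {X = a ∷ []} {c ∷ []} (_ , a+0≡s , _) (_ , c+0≡s , _) =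
  ↭-reflexive (cong [_] (+-cancelʳ-≡ 0 a c (trans a+0≡s (sym c+0≡s))))
singleton-determined {X = []} (_ , _ , _ , ())
singleton-determined {X = _ ∷ _ ∷ _} (_ , _ , _ , ())
singleton-determined {X = _ ∷ []} {[]} _ (_ , _ , _ , ())
singleton-determined {X = _ ∷ []} {_ ∷ _ ∷ _} _ (_ , _ , _ , ())

pair-determined : ∀ {s p X Y} → HasT s p 2 X → HasT s p 2 Y → X ↭ Y
pair-determined {X = a ∷ b ∷ []} {c ∷ d ∷ []} (_ , sumX , productX , _) (_ , sumY , productY , _)
  with pair-sum-product {a} {b} {c} {d}
         (trans (cong (a +_) (sym (+-identityʳ b))) (trans sumX (trans (sym sumY) (cong (c +_) (+-identityʳ d)))))
         (trans (cong (a *_) (sym (*-identityʳ b))) (trans productX (trans (sym productY) (cong (c *_) (*-identityʳ d)))))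
... | inj₁ (refl , refl) = ↭-refl
... | inj₂ (refl , refl) = swap a b ↭-refl
pair-determined {X = []} (_ , _ , _ , ())
pair-determined {X = _ ∷ []} (_ , _ , _ , ())
pair-determined {X = _ ∷ _ ∷ _ ∷ _} (_ , _ , _ , ())
pair-determined {X = _ ∷ _ ∷ []} {[]} _ (_ , _ , _ , ())
pair-determined {X = _ ∷ _ ∷ []} {_ ∷ []} _ (_ , _ , _ , ())
pair-determined {X = _ ∷ _ ∷ []} {_ ∷ _ ∷ _ ∷ _} _ (_ , _ , _ , ())

lemma2p2 : (s n : ℕ) → 1 ≤ s → 1 ≤ n →
           (n ≡ 1 ⊎ n ≡ 2 ⊎ (n ≤ s × s ≤ n + 7)) →
           (p : ℕ) → 1 ≤ p → ¬ Admissible s p n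
lemma2p2 s n _ _ (inj₁ refl) p _ (X , Y , hX , hY , X≁Y) = X≁Y (singleton-determined hX hY)
lemma2p2 s n _ _ (inj₂ (inj₁ refl)) p _ (X , Y , hX , hY , X≁Y) = X≁Y (pair-determined hX hY)
lemma2p2 s n _ _ (inj₂ (inj₂ (_ , s≤n+7))) p _ (X , Y , hX , hY , X≁Y) = X≁Y (excess≤7-determined s≤n+7 hX hY)
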